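{- Let $G$ and $H$ be connected graphs (without isolated vertices). Let $G'$ be obtained from $G$ by adding a new vertex $v'$ and a single edge joining $v'$ to some vertex $v\in V(G)$. Then $$\gamma_{\mathrm{pr}}(G'\times H)\le 2\big(\gamma_{\mathrm{pr}}(G\times H)+\gamma_{\mathrm{pr}}(H)\big).$$
   Context: All graphs are finite and simple. The direct product $G\times H$ has vertex set $V(G)\times V(H)$, with $(u_G,u_H)$ adjacent to $(v_G,v_H)$ iff $u_Gv_G\in E(G)$ and $u_Hv_H\in E(H)$. A set $D$ is dominating if every vertex is in $D$ or adjacent to a vertex of $D$. For a graph without isolated vertices, $\gamma_{\mathrm{pr}}$ is the minimum size of a dominating set whose induced subgraph has a perfect matching. Paired domination numbers are only considered for graphs without isolated vertices. -}

module Defs where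

open import Data.Nat using (ℕ; _≤_)
open import Data.Empty using (⊥)
open import Data.Maybe using (Maybe; just; nothing)
open import Data.Product using (Σ; ∃; _×_; _,_; proj₁; proj₂)
open import Data.Sum using (_⊎_)
open import Data.List using (List; _∷_; []; map; length; cartesianProduct)
open import Data.List.Membership.Propositional using (_∈_)
open import Data.List.Membership.Propositional.Properties using (∈-map⁺; ∈-cartesianProduct⁺)
open import Data.List.Relation.Unary.Unique.Propositional using (Unique; _∷_)
open import Data.List.Relation.Unary.Unique.Propositional.Properties as UP using ()
open import Data.List.Relation.Unary.All using (All; []; _∷_)
open import Data.List.Relation.Unary.Any using (here; there)
open import Relation.Nullary using (¬_)
open import Relation.Binary.PropositionalEquality using (_≡_; refl)

record Graph : Set₁ where
  field
    V        : Set
    E        : V → V → Set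
    sym      : ∀ {x y} → E x y → E y x
    irrefl   : ∀ {x} → ¬ E x x
    verts    : List V
    complete : ∀ x → x ∈ verts
    unique   : Unique verts
open Graph public

data Reach (G : Graph) : V G → V G → Set where
  here  : ∀ {x} → Reach G x x
  step  : ∀ {x y z} → E G x y → Reach G y z → Reach G x z

Connected : Graph → Set
Connected G = ∀ x y → Reach G x y

NoIsolated : Graph → Set
NoIsolated G = ∀ x → ∃ λ y → E G x y

_⊠_ : Graph → Graph → Graph
G ⊠ H = record
  { V        = V G × V H
  ; E        = λ p q → E G (proj₁ p) (proj₁ q) × E H (proj₂ p) (proj₂ q)
  ; sym      = λ { (a , b) → sym G a , sym H b }
  ; irrefl   = λ { (a , _) → irrefl G a }
  ; verts    = cartesianProduct (verts G) (verts H)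
  ; complete = λ { (x , y) → ∈-cartesianProduct⁺ (complete G x) (complete H y) }
  ; unique   = UP.cartesianProduct⁺ (unique G) (unique H)
  }

-- G' : add a new vertex v' (= nothing) joined by one edge to v (= just v).
module _ (G : Graph) (v : V G) where
  private
    E' : Maybe (V G) → Maybe (V G) → Set
    E' (just x) (just y) = E G x y
    E' (just x) nothing  = x ≡ v
    E' nothing  (just y) = y ≡ v
    E' nothing  nothing  = ⊥

    sym' : ∀ {x y} → E' x y → E' y x
    sym' {just x} {just y} e = sym G e
    sym' {just x} {nothing} e = e
    sym' {nothing} {just y} e = e

    irrefl' : ∀ {x} → ¬ E' x x
    irrefl' {just x} e = irrefl G e

    just-inj : ∀ {x y : V G} → just x ≡ just y → x ≡ y
    just-inj refl = refl

    fresh : ∀ (xs : List (V G)) → All (λ y → ¬ (nothing ≡ y)) (map just xs)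
    fresh [] = []
    fresh (x ∷ xs) = (λ ()) ∷ fresh xs

    complete' : ∀ x → x ∈ (nothing ∷ map just (verts G))
    complete' nothing  = here refl
    complete' (just x) = there (∈-map⁺ just (complete G x))

  addPendant : Graph
  addPendant = record
    { V        = Maybe (V G)
    ; E        = E'
    ; sym      = λ {x} {y} → sym' {x} {y}
    ; irrefl   = λ {x} → irrefl' {x}
    ; verts    = nothing ∷ map just (verts G)
    ; complete = complete'
    ; unique   = fresh (verts G) ∷ UP.map⁺ just-inj (unique G)
    }

Dominating : (G : Graph) → List (V G) → Set
Dominating G D = ∀ x → x ∈ D ⊎ (∃ λ y → y ∈ D × E G x y)

-- The subgraph induced by D has a perfect matching: a partner function m
-- with m x ∈ D, x adjacent to m x, and m (m x) ≡ x for all x ∈ D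
-- (fixed-point-freeness follows from irreflexivity).
HasPerfectMatching : (G : Graph) → List (V G) → Set
HasPerfectMatching G D =
  Σ (V G → V G) λ m → ∀ x → x ∈ D → (m x ∈ D) × E G x (m x) × (m (m x) ≡ x)

IsPairedDom : (G : Graph) → List (V G) → Set
IsPairedDom G D = Unique D × Dominating G D × HasPerfectMatching G D

γpr : Graph → ℕ → Set
γpr G k = (∃ λ D → IsPairedDom G D × length D ≡ k)
        × (∀ D → IsPairedDom G D → k ≤ length D)

module Submission where

open import Defs
open import Data.Nat using (ℕ; _≤_; _*_; _+_)
open import Data.Nat.Properties using (≤-trans; ≤-reflexive; +-monoʳ-≤; +-mono-≤; m≤n+m; module ≤-Reasoning)
open import Data.Nat.Tactic.RingSolver using (solve-∀)
open import Data.Maybe using (just; nothing)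
open import Data.Product using (_×_; _,_; proj₁; proj₂)
open import Data.Sum using (inj₁; inj₂)
open import Data.Empty using (⊥-elim)
open import Data.List using (List; _∷_; map; length; _++_; filter; deduplicate)
open import Data.List.Properties using (length-++; length-map; length-filter; length-deduplicate)
open import Data.List.Membership.Propositional using (_∈_)
open import Data.List.Membership.Propositional.Properties
  using (∈-map⁺; ∈-map⁻; ∈-++⁺ˡ; ∈-++⁺ʳ; ∈-++⁻; ∈-filter⁺; ∈-filter⁻; ∈-deduplicate⁺; ∈-deduplicate⁻)
import Data.List.Membership.DecPropositional as DecMembership
open import Data.List.Relation.Unary.Unique.Propositional using (Unique; _∷_)
open import Data.List.Relation.Unary.Unique.DecPropositional.Properties using (deduplicate-!)
import Data.List.Relation.Unary.All as All
open import Data.List.Relation.Unary.Any using (here; there)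
open import Relation.Nullary using (¬_; Dec; yes; no; ¬?)
open import Relation.Binary.Definitions using (DecidableEquality)
open import Relation.Binary.PropositionalEquality using (_≡_; refl; trans; cong; cong₂; subst; module ≡-Reasoning) renaming (sym to ≡-sym)

-- Let D be a paired dominating set of G × H and S one of H, with matchings
-- m_D and m_S. Keep D on the copy of G × H inside G' × H, and for every s ∈ S
-- with (v, s) ∉ D add the matched pair (v, s) — (v', m_S s). Every (v', h)
-- is dominated through (v, m_S h) or (v, t) for a neighbour t ∈ S of h, each of
-- which lies in D or was added. This gives a paired dominating set of size at
-- most |D| + 2|S| ≤ 2 (|D| + |S|).

Unique-∈-≟ : ∀ {A : Set} {xs : List A} → Unique xs → ∀ {x y} → x ∈ xs → y ∈ xs → Dec (x ≡ y)
Unique-∈-≟ (_ ∷ _)        (here refl) (here refl) = yes refl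
Unique-∈-≟ (x∉xs ∷ _)     (here refl) (there y∈)  = no λ x≡y → All.lookup x∉xs y∈ x≡y
Unique-∈-≟ (x∉xs ∷ _)     (there x∈)  (here refl) = no λ x≡y → All.lookup x∉xs x∈ (≡-sym x≡y)
Unique-∈-≟ (_ ∷ unique-xs) (there x∈)  (there y∈)  = Unique-∈-≟ unique-xs x∈ y∈

vertex-≟ : (G : Graph) → DecidableEquality (V G)
vertex-≟ G x y = Unique-∈-≟ (unique G) (complete G x) (complete G y)

deduplicate-isPairedDom : (G : Graph) (L : List (V G))
  → Dominating G L → HasPerfectMatching G L
  → IsPairedDom G (deduplicate (vertex-≟ G) L)
deduplicate-isPairedDom G L dom (m , match) = deduplicate-! (vertex-≟ G) L , dom′ , (m , match′)
  where
  ∈-dedup⁺ : ∀ {x} → x ∈ L → x ∈ deduplicate (vertex-≟ G) L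
  ∈-dedup⁺ = ∈-deduplicate⁺ (vertex-≟ G)

  dom′ : Dominating G (deduplicate (vertex-≟ G) L)
  dom′ x with dom x
  ... | inj₁ x∈ = inj₁ (∈-dedup⁺ x∈)
  ... | inj₂ (y , y∈ , e) = inj₂ (y , ∈-dedup⁺ y∈ , e)

  match′ : ∀ x → x ∈ deduplicate (vertex-≟ G) L → (m x ∈ deduplicate (vertex-≟ G) L) × E G x (m x) × (m (m x) ≡ x)
  match′ x x∈ with match x (∈-deduplicate⁻ (vertex-≟ G) L x∈)
  ... | mx∈ , e , mmx = ∈-dedup⁺ mx∈ , e , mmx

module PendantProduct (G H : Graph) (v : V G)
  (D : List (V (G ⊠ H))) (dom-D : Dominating (G ⊠ H) D) (match-D : HasPerfectMatching (G ⊠ H) D)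
  (S : List (V H)) (dom-S : Dominating H S) (match-S : HasPerfectMatching H S) where

  P : Graph
  P = addPendant G v ⊠ H

  mD : V (G ⊠ H) → V (G ⊠ H)
  mD = proj₁ match-D

  mS : V H → V H
  mS = proj₁ match-S

  _∈D? : ∀ x → Dec (x ∈ D)
  x ∈D? = DecMembership._∈?_ (vertex-≟ (G ⊠ H)) x D

  embed : V (G ⊠ H) → V P
  embed (x , h) = (just x , h)

  atV : V H → V P
  atV s = (just v , s)

  atPendant : V H → V P
  atPendant s = (nothing , mS s)

  Uncovered : V H → Set
  Uncovered s = ¬ ((v , s) ∈ D)

  uncovered? : ∀ s → Dec (Uncovered s)
  uncovered? s = ¬? ((v , s) ∈D?)

  uncovered : List (V H)
  uncovered = filter uncovered? S

  L : List (V P)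
  L = map embed D ++ (map atV uncovered ++ map atPendant uncovered)

  partner : V P → V P
  partner (nothing , h) = (just v , mS h)
  partner (just x , h) with (x , h) ∈D?
  ... | yes _ = embed (mD (x , h))
  ... | no _  = (nothing , mS h)

  partner-embed : ∀ p → p ∈ D → partner (embed p) ≡ embed (mD p)
  partner-embed (x , h) p∈ with (x , h) ∈D?
  ... | yes _ = refl
  ... | no p∉ = ⊥-elim (p∉ p∈)

  partner-atV : ∀ s → Uncovered s → partner (atV s) ≡ atPendant s
  partner-atV s s∉ with (v , s) ∈D?
  ... | yes s∈ = ⊥-elim (s∉ s∈)
  ... | no _   = refl

  embed∈L : ∀ {p} → p ∈ D → embed p ∈ L
  embed∈L p∈ = ∈-++⁺ˡ (∈-map⁺ embed p∈)

  uncovered⁺ : ∀ {s} → s ∈ S → Uncovered s → s ∈ uncovered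
  uncovered⁺ s∈ s∉ = ∈-filter⁺ uncovered? s∈ s∉

  atV∈L : ∀ {s} → s ∈ S → Uncovered s → atV s ∈ L
  atV∈L s∈ s∉ = ∈-++⁺ʳ (map embed D) (∈-++⁺ˡ (∈-map⁺ atV (uncovered⁺ s∈ s∉)))

  atPendant∈L : ∀ {s} → s ∈ S → Uncovered s → atPendant s ∈ L
  atPendant∈L s∈ s∉ = ∈-++⁺ʳ (map embed D) (∈-++⁺ʳ (map atV uncovered) (∈-map⁺ atPendant (uncovered⁺ s∈ s∉)))

  fibre-v∈L : ∀ {t} → t ∈ S → atV t ∈ L
  fibre-v∈L {t} t∈ with (v , t) ∈D?
  ... | yes vt∈ = embed∈L vt∈
  ... | no vt∉  = atV∈L t∈ vt∉

  L-dominating : Dominating P L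
  L-dominating (just x , h) with dom-D (x , h)
  ... | inj₁ xh∈ = inj₁ (embed∈L xh∈)
  ... | inj₂ (y , y∈ , e) = inj₂ (embed y , embed∈L y∈ , e)
  L-dominating (nothing , h) with dom-S h
  ... | inj₁ h∈ = let (mh∈ , e , _) = proj₂ match-S h h∈
                  in inj₂ (atV (mS h) , fibre-v∈L mh∈ , refl , e)
  ... | inj₂ (t , t∈ , e) = inj₂ (atV t , fibre-v∈L t∈ , refl , e)

  MatchedIn : V P → Set
  MatchedIn x = (partner x ∈ L) × E P x (partner x) × (partner (partner x) ≡ x)

  embed-matched : ∀ {p} → p ∈ D → MatchedIn (embed p)
  embed-matched {p} p∈ =
      subst (_∈ L) (≡-sym (partner-embed p p∈)) (embed∈L mp∈)
    , subst (E P (embed p)) (≡-sym (partner-embed p p∈)) e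
    , (begin
        partner (partner (embed p)) ≡⟨ cong partner (partner-embed p p∈) ⟩
        partner (embed (mD p))      ≡⟨ partner-embed (mD p) mp∈ ⟩
        embed (mD (mD p))           ≡⟨ cong embed mmp ⟩
        embed p                     ∎)
    where
    open ≡-Reasoning
    mp∈ = proj₁ (proj₂ match-D p p∈)
    e   = proj₁ (proj₂ (proj₂ match-D p p∈))
    mmp = proj₂ (proj₂ (proj₂ match-D p p∈))

  atV-matched : ∀ {s} → s ∈ S → Uncovered s → MatchedIn (atV s)
  atV-matched {s} s∈ s∉ with proj₂ match-S s s∈
  ... | _ , e , mms rewrite partner-atV s s∉ =
    atPendant∈L s∈ s∉ , (refl , e) , cong atV mms

  atPendant-matched : ∀ {s} → s ∈ S → Uncovered s → MatchedIn (atPendant s)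
  atPendant-matched {s} s∈ s∉ with proj₂ match-S s s∈
  ... | ms∈ , _ , mms =
      subst (λ t → atV t ∈ L) (≡-sym mms) (atV∈L s∈ s∉)
    , (refl , proj₁ (proj₂ (proj₂ match-S (mS s) ms∈)))
    , trans (partner-atV (mS (mS s)) (subst Uncovered (≡-sym mms) s∉)) (cong atPendant mms)

  L-matching : HasPerfectMatching P L
  L-matching = partner , matched
    where
    matched : ∀ x → x ∈ L → MatchedIn x
    matched x x∈ with ∈-++⁻ (map embed D) x∈
    ... | inj₁ x∈D with ∈-map⁻ embed x∈D
    ...   | _ , p∈ , refl = embed-matched p∈
    matched x x∈ | inj₂ x∈new with ∈-++⁻ (map atV uncovered) x∈new
    ... | inj₁ x∈A with ∈-map⁻ atV x∈A
    ...   | _ , s∈ , refl = let (s∈S , s∉) = ∈-filter⁻ uncovered? s∈ in atV-matched s∈S s∉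
    matched x x∈ | inj₂ x∈new | inj₂ x∈B with ∈-map⁻ atPendant x∈B
    ... | _ , s∈ , refl = let (s∈S , s∉) = ∈-filter⁻ uncovered? s∈ in atPendant-matched s∈S s∉

  length-L : length L ≤ length D + (length S + length S)
  length-L = begin
    length L                                                                   ≡⟨ length-++ (map embed D) ⟩
    length (map embed D) + length (map atV uncovered ++ map atPendant uncovered) ≡⟨ cong (length (map embed D) +_) (length-++ (map atV uncovered)) ⟩
    length (map embed D) + (length (map atV uncovered) + length (map atPendant uncovered))
      ≡⟨ cong₂ _+_ (length-map embed D) (cong₂ _+_ (length-map atV uncovered) (length-map atPendant uncovered)) ⟩
    length D + (length uncovered + length uncovered)
      ≤⟨ +-monoʳ-≤ (length D) (+-mono-≤ uncovered≤S uncovered≤S) ⟩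
    length D + (length S + length S) ∎
    where
    open ≤-Reasoning
    uncovered≤S : length uncovered ≤ length S
    uncovered≤S = length-filter uncovered? S

b+2c≤2[b+c] : ∀ b c → b + (c + c) ≤ 2 * (b + c)
b+2c≤2[b+c] b c = ≤-trans (+-monoʳ-≤ b (+-monoʳ-≤ c (m≤n+m c b))) (≤-reflexive (identity b c))
  where
  identity : ∀ b c → b + (c + (b + c)) ≡ 2 * (b + c)
  identity = solve-∀

lemma4 : (G H : Graph) (v : V G)
    → Connected G → NoIsolated G
    → Connected H → NoIsolated H
    → (a b c : ℕ)
    → γpr (addPendant G v ⊠ H) a
    → γpr (G ⊠ H) b
    → γpr H c
    → a ≤ 2 * (b + c)
lemma4 G H v _ _ _ _ a b c (_ , a-minimal) ((D , (_ , dom-D , match-D) , refl) , _) ((S , (_ , dom-S , match-S) , refl) , _) =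
  begin
    a                                           ≤⟨ a-minimal T (deduplicate-isPairedDom P L L-dominating L-matching) ⟩
    length T                                    ≤⟨ length-deduplicate (vertex-≟ P) L ⟩
    length L                                    ≤⟨ length-L ⟩
    length D + (length S + length S)            ≤⟨ b+2c≤2[b+c] (length D) (length S) ⟩
    2 * (length D + length S)                   ∎
  where
  open PendantProduct G H v D dom-D match-D S dom-S match-S
  open ≤-Reasoning
  T = deduplicate (vertex-≟ P) L
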